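{- If $(t,u)^T$ is $n$-planar-feasible, then $(2t+u,t+u)^T=\begin{pmatrix}2&1\\1&1\end{pmatrix}(t,u)^T$ is $(n+1)$-planar-feasible.
   Context: $\tau(G)$ is the number of spanning trees of a (multi)graph $G$ (parallel edges counted as distinct). For an edge $e$ of $G$, $G/e$ is the multigraph obtained by contracting $e$ and $G-e$ the graph obtained by deleting $e$. A vector $(t,u)^T$ of integers is $n$-planar-feasible if there exist a simple planar graph $G$ on at most $n$ vertices and an edge $e\in E(G)$ with $t=\tau(G/e)$ and $u=\tau(G-e)$. -}

module Defs where

open import Data.Nat using (ℕ; zero; suc; _+_; _*_; _≤_)
open import Data.Fin using (Fin; punchIn; punchOut; _≟_)
open import Data.Fin.Subset using (Subset; _∈_; _-_)
open import Data.Bool using (Bool; true; false; not)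
open import Data.Product using (Σ; ∃; _×_; _,_; proj₁; proj₂)
open import Data.Sum using (_⊎_)
open import Data.Vec using (Vec; lookup)
open import Function.Definitions using (Bijective)
open import Relation.Nullary using (¬_; yes; no)
open import Relation.Binary.PropositionalEquality using (_≡_; _≢_; sym)
open import Relation.Binary.Construct.Closure.ReflexiveTransitive using (Star)

-- Multigraphs: vertices Fin nV, edges Fin nE (distinct edges may have
-- equal endpoints = parallel edges), each edge has two endpoints.

record Multigraph : Set where
  field
    nV   : ℕ
    nE   : ℕ
    ends : Fin nE → Fin nV × Fin nV
open Multigraph public

deleteEdge : ∀ {n m} → (Fin (suc m) → Fin n × Fin n) → Fin (suc m) → Multigraph
deleteEdge {n} {m} ends e = record
  { nV = n ; nE = m ; ends = λ j → ends (punchIn e j) }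

mergeVertex : ∀ {n} (a b : Fin (suc n)) → a ≢ b → Fin (suc n) → Fin n
mergeVertex a b a≢b v with v ≟ b
... | yes _   = punchOut {i = b} {j = a} (λ eq → a≢b (sym eq))
... | no v≢b  = punchOut {i = b} {j = v} (λ eq → v≢b (sym eq))

-- G / e : contract the non-loop edge e (its endpoints are merged, e is removed,
-- all other edges are kept, possibly becoming parallel)
contractEdge : ∀ {n m} (ends : Fin (suc m) → Fin (suc n) × Fin (suc n))
               (e : Fin (suc m)) → proj₁ (ends e) ≢ proj₂ (ends e) → Multigraph
contractEdge {n} {m} ends e p = record
  { nV = n ; nE = m
  ; ends = λ j → mg (proj₁ (ends (punchIn e j))) , mg (proj₂ (ends (punchIn e j))) }
  where
    mg : Fin (suc n) → Fin n
    mg = mergeVertex (proj₁ (ends e)) (proj₂ (ends e)) p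

Reach : (G : Multigraph) → Subset (nE G) → Fin (nV G) → Fin (nV G) → Set
Reach G S = Star (λ x y → ∃ λ j → j ∈ S ×
                     ((ends G j ≡ (x , y)) ⊎ (ends G j ≡ (y , x))))

-- S is a spanning tree: (V, S) is connected and acyclic; acyclic means no
-- edge of S lies on a cycle of (V,S), i.e. its endpoints are not joined in S - j
-- (this also excludes loops and pairs of parallel edges).
IsSpanningTree : (G : Multigraph) → Subset (nE G) → Set
IsSpanningTree G S =
  (∀ u v → Reach G S u v) ×
  (∀ j → j ∈ S → ¬ Reach G (S - j) (proj₁ (ends G j)) (proj₂ (ends G j)))

HasTreeCount : Multigraph → ℕ → Set
HasTreeCount G c = Σ (Vec (Subset (nE G)) c) λ ts →
  (∀ i j → lookup ts i ≡ lookup ts j → i ≡ j) ×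
  (∀ i → IsSpanningTree G (lookup ts i)) ×
  (∀ S → IsSpanningTree G S → ∃ λ i → lookup ts i ≡ S)

NumClasses : {A : Set} → (A → A → Set) → ℕ → Set
NumClasses {A} R c = Σ (Vec A c) λ r →
  (∀ i j → R (lookup r i) (lookup r j) → i ≡ j) ×
  (∀ x → ∃ λ i → R (lookup r i) x)

SameEnds : ∀ {k} → Fin k × Fin k → Fin k × Fin k → Set
SameEnds (a , b) (c , d) = (a ≡ c × b ≡ d) ⊎ (a ≡ d × b ≡ c)

IsSimple : ∀ {k m} → (Fin m → Fin k × Fin k) → Set
IsSimple {k} {m} ends =
  (∀ j → proj₁ (ends j) ≢ proj₂ (ends j)) ×
  (∀ i j → SameEnds (ends i) (ends j) → i ≡ j)

-- darts (half-edges): (j , false) is edge j at proj₁, (j , true) at proj₂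
Dart : ℕ → Set
Dart m = Fin m × Bool

tail : ∀ {k m} → (Fin m → Fin k × Fin k) → Dart m → Fin k
tail ends (j , false) = proj₁ (ends j)
tail ends (j , true)  = proj₂ (ends j)

flip : ∀ {m} → Dart m → Dart m
flip (j , b) = (j , not b)

-- rotation system σ: a permutation of darts whose cycles are exactly the
-- sets of darts at each vertex; faces are the cycles of σ ∘ flip.
-- Planar = some rotation system has genus 0 (Euler's formula, per component):
--   #vertex-orbits + #faces = #edges + 2 · #components   (isolated vertices
--   are irrelevant for planarity and do not appear in dart counts).
IsPlanar : ∀ {k m} → (Fin m → Fin k × Fin k) → Set
IsPlanar {k} {m} ends = Σ (Dart m → Dart m) λ σ →
  Bijective _≡_ _≡_ σ ×
  (∀ d → tail ends (σ d) ≡ tail ends d) ×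
  (∀ d d' → tail ends d ≡ tail ends d' → Star (λ x y → y ≡ σ x) d d') ×
  Σ ℕ λ nv → Σ ℕ λ nf → Σ ℕ λ nc →
    NumClasses (Star (λ x y → y ≡ σ x)) nv ×
    NumClasses (Star (λ x y → y ≡ σ (flip x))) nf ×
    NumClasses (Star (λ x y → (y ≡ σ x) ⊎ (y ≡ flip x))) nc ×
    nv + nf ≡ m + 2 * nc

-- (t,u) is n-planar-feasible: there is a simple planar graph G on at most n
-- vertices and an edge e with t = τ(G/e), u = τ(G - e).
-- (A graph with an edge has ≥ 1 edge and ≥ 1 vertex, hence the suc's.)

PlanarFeasible : ℕ → ℕ → ℕ → Set
PlanarFeasible n t u =
  Σ ℕ λ k → Σ ℕ λ m → Σ (Fin (suc m) → Fin (suc k) × Fin (suc k)) λ ends →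
    suc k ≤ n × IsSimple ends × IsPlanar ends ×
    Σ (Fin (suc m)) λ e → Σ (proj₁ (ends e) ≢ proj₂ (ends e)) λ p →
      HasTreeCount (contractEdge ends e p) t × HasTreeCount (deleteEdge ends e) u

-- Let e = ab and add a new vertex v adjacent to a and b; the new graph G′ is still simple and
-- planar (v goes into a face bordering e) and has one more vertex.  Take f = va.  In G′ − f the
-- vertex v is a leaf hanging at b, so τ(G′ − f) = τ(G) = τ(G/e) + τ(G − e) = t + u by
-- deletion–contraction.  In G′/f the edge vb becomes a second copy e′ of e; deletion–contraction
-- at e′ gives τ(G′/f) = τ(G′/f/e′) + τ(G′/f − e′) = t + (t + u), since e is a loop in G′/f/e′
-- (which spanning trees never use) and G′/f − e′ = G.

module Submission where

open import Defs
open import Data.Bool using (Bool; true; false; not)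
open import Data.Bool.Properties using () renaming (_≟_ to _≟ᵇ_)
open import Data.Empty using (⊥; ⊥-elim)
open import Data.Fin using (Fin; zero; suc; punchIn; punchOut; _↑ˡ_; _↑ʳ_; splitAt; join; _≟_)
open import Data.Fin.Properties
  using (0≢1+n; suc-injective; punchIn-injective; punchInᵢ≢i; punchOut-cong; punchOut-injective;
         punchIn-punchOut; punchOut-punchIn; join-splitAt)
open import Data.Fin.Subset using (Subset; _∈_; _∉_; _-_; _─_; ⁅_⁆; inside; outside)
open import Data.Fin.Subset.Properties using (x∈p∧x≢y⇒x∈p-y; p─q⊆p; x∈⁅x⁆)
open import Data.Nat using (ℕ; zero; suc; _+_; _*_; _≤_; z≤n; s≤s)
open import Data.Nat.Properties using (≤-refl; ≤-trans; m≤n⇒m≤1+n; +-assoc; +-identityʳ; +-suc)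
open import Data.Product using (Σ; ∃; _×_; _,_; proj₁; proj₂)
open import Data.Product.Properties using (≡-dec)
open import Data.Sum using (_⊎_; inj₁; inj₂; [_,_]′)
open import Data.Vec using (Vec; _∷_; lookup; map; _++_; insertAt; removeAt; here; there)
open import Data.Vec.Properties
  using (lookup-map; lookup-++ˡ; lookup-++ʳ; []=⇒lookup; lookup⇒[]=; insertAt-lookup; insertAt-punchIn;
         insertAt-removeAt; removeAt-insertAt)
open import Function using (_∘_)
open import Function.Definitions using (Bijective)
open import Relation.Binary.Construct.Closure.ReflexiveTransitive
  using (Star; ε; _◅_; _◅◅_; reverse; kleisliStar; return) renaming (map to Star-map)
open import Relation.Binary.Construct.Closure.ReflexiveTransitive.Properties using (reflexive)
open import Relation.Binary.PropositionalEquality using (_≡_; _≢_; refl; sym; trans; cong; subst; subst₂)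
open import Relation.Nullary using (¬_; yes; no; Dec)
open import Relation.Unary using (_⊆_; _≐_)

-- Walks and counting

gmap-collapsing : ∀ {A B : Set} {R : A → A → Set} {R′ : B → B → Set} (f : A → B) →
                  (∀ {x y} → R x y → f x ≡ f y ⊎ R′ (f x) (f y)) →
                  ∀ {x y} → Star R x y → Star R′ (f x) (f y)
gmap-collapsing {R′ = R′} f h = kleisliStar f (λ r → [ reflexive R′ , return ]′ (h r))

length : ∀ {A : Set} {R : A → A → Set} {x y} → Star R x y → ℕ
length ε        = 0
length (_ ◅ rs) = suc (length rs)

length-map : ∀ {A : Set} {R R′ : A → A → Set} (f : ∀ {x y} → R x y → R′ x y) {x y} (w : Star R x y) →
             length (Star-map f w) ≡ length w
length-map f ε       = refl
length-map f (r ◅ w) = cong suc (length-map f w)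

HasCardinality : {A : Set} → (A → Set) → ℕ → Set
HasCardinality {A} Q c = Σ (Vec A c) λ xs →
  (∀ i j → lookup xs i ≡ lookup xs j → i ≡ j) ×
  (∀ i → Q (lookup xs i)) ×
  (∀ x → Q x → ∃ λ i → lookup xs i ≡ x)

HasCardinality-bij : ∀ {A B : Set} {P : A → Set} {Q : B → Set} {c} →
  (f : A → B) (g : B → A) →
  (∀ x → P x → Q (f x)) → (∀ y → Q y → P (g y)) →
  (∀ y → Q y → f (g y) ≡ y) → (∀ x x′ → f x ≡ f x′ → x ≡ x′) →
  HasCardinality P c → HasCardinality Q c
HasCardinality-bij {Q = Q} f g P⇒Q Q⇒P fg≡id f-inj (xs , inj , ok , cov) =
  map f xs ,
  (λ i j eq → inj i j (f-inj _ _ (trans (sym (lookup-map i f xs)) (trans eq (lookup-map j f xs))))) ,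
  (λ i → subst Q (sym (lookup-map i f xs)) (P⇒Q _ (ok i))) ,
  λ y qy → let (i , eq) = cov (g y) (Q⇒P y qy) in
    i , trans (lookup-map i f xs) (trans (cong f eq) (fg≡id y qy))

HasCardinality-cong : ∀ {A : Set} {P Q : A → Set} {c} → P ≐ Q → HasCardinality P c → HasCardinality Q c
HasCardinality-cong (P⊆Q , Q⊆P) =
  HasCardinality-bij (λ x → x) (λ x → x) (λ _ → P⊆Q) (λ _ → Q⊆P) (λ _ _ → refl) (λ _ _ eq → eq)

HasCardinality-⊎ : ∀ {A : Set} {P Q R : A → Set} {a b} →
  (∀ x → R x → P x ⊎ Q x) → (∀ x → P x → R x) → (∀ x → Q x → R x) → (∀ x → P x → ¬ Q x) →
  HasCardinality P a → HasCardinality Q b → HasCardinality R (a + b)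
HasCardinality-⊎ {P = P} {Q} {R} {a} {b} split P⇒R Q⇒R disjoint
                 (xs , injˣ , okˣ , covˣ) (ys , injʸ , okʸ , covʸ) =
  xs ++ ys , inj , ok , cov
  where
  View : Fin (a + b) → Set
  View k = (∃ λ i → lookup (xs ++ ys) k ≡ lookup xs i × k ≡ i ↑ˡ b) ⊎
           (∃ λ j → lookup (xs ++ ys) k ≡ lookup ys j × k ≡ a ↑ʳ j)
  view : ∀ k → View k
  view k with splitAt a k | join-splitAt a b k
  ... | inj₁ i | refl = inj₁ (i , lookup-++ˡ xs ys i , refl)
  ... | inj₂ j | refl = inj₂ (j , lookup-++ʳ xs ys j , refl)
  inj : ∀ k l → lookup (xs ++ ys) k ≡ lookup (xs ++ ys) l → k ≡ l
  inj k l eq with view k | view l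
  ... | inj₁ (i , e₁ , refl) | inj₁ (i′ , e₂ , refl) =
        cong (_↑ˡ b) (injˣ i i′ (trans (sym e₁) (trans eq e₂)))
  ... | inj₂ (j , e₁ , refl) | inj₂ (j′ , e₂ , refl) =
        cong (a ↑ʳ_) (injʸ j j′ (trans (sym e₁) (trans eq e₂)))
  ... | inj₁ (i , e₁ , refl) | inj₂ (j′ , e₂ , refl) =
        ⊥-elim (disjoint _ (okˣ i) (subst Q (trans (sym e₂) (trans (sym eq) e₁)) (okʸ j′)))
  ... | inj₂ (j , e₁ , refl) | inj₁ (i′ , e₂ , refl) =
        ⊥-elim (disjoint _ (okˣ i′) (subst Q (trans (sym e₁) (trans eq e₂)) (okʸ j)))
  ok : ∀ k → R (lookup (xs ++ ys) k)
  ok k with view k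
  ... | inj₁ (i , e₁ , _) = subst R (sym e₁) (P⇒R _ (okˣ i))
  ... | inj₂ (j , e₁ , _) = subst R (sym e₁) (Q⇒R _ (okʸ j))
  cov : ∀ x → R x → ∃ λ k → lookup (xs ++ ys) k ≡ x
  cov x rx with split x rx
  ... | inj₁ px = let (i , eq) = covˣ x px in i ↑ˡ b , trans (lookup-++ˡ xs ys i) eq
  ... | inj₂ qx = let (j , eq) = covʸ x qx in a ↑ʳ j , trans (lookup-++ʳ xs ys j) eq

-- Spanning trees as edge predicates

x∈p─q⇒x∉q : ∀ {n} (p q : Subset n) {x} → x ∈ p ─ q → x ∉ q
x∈p─q⇒x∉q (_ ∷ p) (outside ∷ q) here = λ ()
x∈p─q⇒x∉q (_ ∷ p) (outside ∷ q) (there x∈) (there x∈q) = x∈p─q⇒x∉q p q x∈ x∈q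
x∈p─q⇒x∉q (_ ∷ p) (inside ∷ q)  (there x∈) (there x∈q) = x∈p─q⇒x∉q p q x∈ x∈q

x∈p-y⇒x≢y : ∀ {n} (p : Subset n) {x y} → x ∈ p - y → x ≢ y
x∈p-y⇒x≢y p {y = y} x∈ refl = x∈p─q⇒x∉q p ⁅ y ⁆ x∈ (x∈⁅x⁆ y)

graph : ∀ {n m} → (Fin m → Fin n × Fin n) → Multigraph
graph {n} {m} en = record { nV = n ; nE = m ; ends = en }

Adjacent : (G : Multigraph) → (Fin (nE G) → Set) → Fin (nV G) → Fin (nV G) → Set
Adjacent G P x y = ∃ λ j → P j × ((ends G j ≡ (x , y)) ⊎ (ends G j ≡ (y , x)))

Path : (G : Multigraph) → (Fin (nE G) → Set) → Fin (nV G) → Fin (nV G) → Set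
Path G P = Star (Adjacent G P)

_∖_ : ∀ {m} → (Fin m → Set) → Fin m → Fin m → Set
(P ∖ j) i = P i × i ≢ j

IsTree : (G : Multigraph) → (Fin (nE G) → Set) → Set
IsTree G P = (∀ u v → Path G P u v) ×
             (∀ j → P j → ¬ Path G (P ∖ j) (proj₁ (ends G j)) (proj₂ (ends G j)))

Adjacent-sym : ∀ {G P x y} → Adjacent G P x y → Adjacent G P y x
Adjacent-sym (j , pj , inj₁ o) = j , pj , inj₂ o
Adjacent-sym (j , pj , inj₂ o) = j , pj , inj₁ o

Path-reverse : ∀ {G P x y} → Path G P x y → Path G P y x
Path-reverse = reverse Adjacent-sym

Path-mono : ∀ {G} {P Q : Fin (nE G) → Set} → P ⊆ Q → ∀ {x y} → Path G P x y → Path G Q x y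
Path-mono P⊆Q = Star-map λ (j , pj , o) → j , P⊆Q pj , o

IsTree-cong : ∀ {G} {P Q : Fin (nE G) → Set} → P ≐ Q → IsTree G P → IsTree G Q
IsTree-cong (P⊆Q , Q⊆P) (conn , acyc) =
  (λ u v → Path-mono P⊆Q (conn u v)) ,
  λ j qj w → acyc j (Q⊆P qj) (Path-mono (λ (qi , i≢j) → Q⊆P qi , i≢j) w)

IsSpanningTree⇒IsTree : ∀ {G} {S : Subset (nE G)} → IsSpanningTree G S → IsTree G (_∈ S)
IsSpanningTree⇒IsTree {S = S} (conn , acyc) =
  conn , λ j j∈S w → acyc j j∈S (Path-mono (λ (i∈S , i≢j) → x∈p∧x≢y⇒x∈p-y i∈S i≢j) w)

IsTree⇒IsSpanningTree : ∀ {G} {S : Subset (nE G)} → IsTree G (_∈ S) → IsSpanningTree G S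
IsTree⇒IsSpanningTree {S = S} (conn , acyc) =
  conn , λ j j∈S w → acyc j j∈S (Path-mono (λ i∈ → p─q⊆p S _ i∈ , x∈p-y⇒x≢y S i∈) w)

PunchedIn : ∀ {m} → Fin (suc m) → (Fin m → Set) → Fin (suc m) → Set
PunchedIn e T i = ∃ λ j → i ≡ punchIn e j × T j

Insert : ∀ {m} → Fin (suc m) → (Fin m → Set) → Fin (suc m) → Set
Insert e T i = i ≡ e ⊎ PunchedIn e T i

∈insertAt⁻ : ∀ {m} (T : Subset m) e b {i} → i ∈ insertAt T e b → (i ≡ e × b ≡ true) ⊎ PunchedIn e (_∈ T) i
∈insertAt⁻ {m} T e b {i} i∈ with i ≟ e
... | yes refl = inj₁ (refl , trans (sym (insertAt-lookup T e b)) ([]=⇒lookup i∈))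
... | no i≢e = inj₂ (j , sym punchIn-j , lookup⇒[]= j T lookup-j)
  where
  j : Fin m
  j = punchOut {i = e} {j = i} (λ eq → i≢e (sym eq))
  punchIn-j : punchIn e j ≡ i
  punchIn-j = punchIn-punchOut _
  lookup-j : lookup T j ≡ inside
  lookup-j = trans (sym (insertAt-punchIn T e b j))
                   (trans (cong (lookup (insertAt T e b)) punchIn-j) ([]=⇒lookup i∈))

PunchedIn⊆∈insertAt : ∀ {m} (T : Subset m) e b → PunchedIn e (_∈ T) ⊆ (_∈ insertAt T e b)
PunchedIn⊆∈insertAt T e b (j , refl , j∈T) =
  lookup⇒[]= _ _ (trans (insertAt-punchIn T e b j) ([]=⇒lookup j∈T))

∈insertAt-false : ∀ {m} (T : Subset m) e → (_∈ insertAt T e false) ≐ PunchedIn e (_∈ T)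
∈insertAt-false T e = from , PunchedIn⊆∈insertAt T e false
  where
  from : (_∈ insertAt T e false) ⊆ PunchedIn e (_∈ T)
  from i∈ with ∈insertAt⁻ T e false i∈
  ... | inj₂ p = p

∈insertAt-true : ∀ {m} (T : Subset m) e → (_∈ insertAt T e true) ≐ Insert e (_∈ T)
∈insertAt-true T e = from , to
  where
  from : (_∈ insertAt T e true) ⊆ Insert e (_∈ T)
  from i∈ with ∈insertAt⁻ T e true i∈
  ... | inj₁ (i≡e , _) = inj₁ i≡e
  ... | inj₂ p = inj₂ p
  to : Insert e (_∈ T) ⊆ (_∈ insertAt T e true)
  to (inj₁ refl) = lookup⇒[]= e (insertAt T e true) (insertAt-lookup T e true)
  to (inj₂ p) = PunchedIn⊆∈insertAt T e true p

insertAt-removeAt-lookup : ∀ {m} {A : Set} (S : Vec A (suc m)) e {b} → lookup S e ≡ b →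
                           insertAt (removeAt S e) e b ≡ S
insertAt-removeAt-lookup S e refl = insertAt-removeAt S e

module _ {G : Multigraph} {n} (en : Fin (suc (nE G)) → Fin n × Fin n) (e : Fin (suc (nE G))) (b : Bool)
         (F : (Fin (nE G) → Set) → Fin (suc (nE G)) → Set)
         (∈insertAt≐F : ∀ T → (_∈ insertAt T e b) ≐ F (_∈ T))
         (IsTree-F⁺ : ∀ {T} → IsTree G T → IsTree (graph en) (F T))
         (IsTree-F⁻ : ∀ {T} → IsTree (graph en) (F T) → IsTree G T) where

  HasTreeCount-insertAt : ∀ {c} → HasTreeCount G c →
    HasCardinality (λ S → IsSpanningTree (graph en) S × lookup S e ≡ b) c
  HasTreeCount-insertAt =
    HasCardinality-bij (λ T → insertAt T e b) (λ S → removeAt S e)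
      (λ T tree → insert-tree T tree , insertAt-lookup T e b)
      (λ S (tree , S[e]≡b) → remove-tree S tree S[e]≡b)
      (λ S (_ , S[e]≡b) → insertAt-removeAt-lookup S e S[e]≡b)
      (λ T T′ eq → trans (sym (removeAt-insertAt T e b))
                     (trans (cong (λ S → removeAt S e) eq) (removeAt-insertAt T′ e b)))
    where
    insert-tree : ∀ T → IsSpanningTree G T → IsSpanningTree (graph en) (insertAt T e b)
    insert-tree T tree =
      IsTree⇒IsSpanningTree (IsTree-cong (proj₂ (∈insertAt≐F T) , proj₁ (∈insertAt≐F T))
                                         (IsTree-F⁺ (IsSpanningTree⇒IsTree tree)))
    remove-tree : ∀ S → IsSpanningTree (graph en) S → lookup S e ≡ b → IsSpanningTree G (removeAt S e)
    remove-tree S tree S[e]≡b = IsTree⇒IsSpanningTree (IsTree-F⁻ (IsTree-cong ≐F (IsSpanningTree⇒IsTree tree)))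
      where
      re : insertAt (removeAt S e) e b ≡ S
      re = insertAt-removeAt-lookup S e S[e]≡b
      ≐F : (_∈ S) ≐ F (_∈ removeAt S e)
      ≐F = (λ i∈ → proj₁ (∈insertAt≐F _) (subst (_ ∈_) (sym re) i∈)) ,
           (λ f → subst (_ ∈_) re (proj₂ (∈insertAt≐F _) f))

-- Deletion and contraction

module _ {n m : ℕ} (en : Fin (suc m) → Fin n × Fin n) (e : Fin (suc m)) where

  private
    G G-e : Multigraph
    G = graph en
    G-e = deleteEdge en e

  Path-punchIn : ∀ {T : Fin m → Set} {Q : Fin (suc m) → Set} → (∀ j → T j → Q (punchIn e j)) →
                 ∀ {x y} → Path G-e T x y → Path G Q x y
  Path-punchIn h = Star-map λ (j , tj , o) → punchIn e j , h j tj , o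

  Path-punchOut : ∀ {T : Fin m → Set} {Q : Fin (suc m) → Set} → Q ⊆ PunchedIn e T →
                  ∀ {x y} → Path G Q x y → Path G-e T x y
  Path-punchOut Q⊆ = Star-map λ (i , qi , o) → step (Q⊆ qi) o
    where
    step : ∀ {T x y i} → PunchedIn e T i → (en i ≡ (x , y)) ⊎ (en i ≡ (y , x)) → Adjacent G-e T x y
    step (j , refl , tj) o = j , tj , o

  IsTree-deleteEdge⁺ : ∀ {T} → IsTree G-e T → IsTree G (PunchedIn e T)
  IsTree-deleteEdge⁺ {T} (conn , acyc) = (λ u v → Path-punchIn (λ j tj → j , refl , tj) (conn u v)) , acyc′
    where
    acyc′ : ∀ i → PunchedIn e T i → ¬ Path G (PunchedIn e T ∖ i) (proj₁ (en i)) (proj₂ (en i))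
    acyc′ _ (j , refl , tj) w =
      acyc j tj (Path-punchOut (λ { ((j′ , refl , tj′) , ne) → j′ , refl , (tj′ , λ eq → ne (cong (punchIn e) eq)) })
                               w)

  IsTree-deleteEdge⁻ : ∀ {T} → IsTree G (PunchedIn e T) → IsTree G-e T
  IsTree-deleteEdge⁻ (conn , acyc) =
    (λ u v → Path-punchOut (λ p → p) (conn u v)) ,
    λ j tj w → acyc (punchIn e j) (j , refl , tj)
      (Path-punchIn (λ j′ (tj′ , ne) → (j′ , refl , tj′) , λ eq → ne (punchIn-injective e j′ j eq)) w)

  HasTreeCount-deleteEdge : ∀ {u} → HasTreeCount G-e u →
                            HasCardinality (λ S → IsSpanningTree G S × lookup S e ≡ false) u
  HasTreeCount-deleteEdge = HasTreeCount-insertAt en e false (PunchedIn e) (λ T → ∈insertAt-false T e)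
                              IsTree-deleteEdge⁺ IsTree-deleteEdge⁻

module _ (G : Multigraph) (P : Fin (nE G) → Set) (j : Fin (nE G)) where

  data PathSplit (p q u v : Fin (nV G)) (ℓ : ℕ) : Set where
    avoiding : (w : Path G (P ∖ j) u v) → length w ≤ ℓ → PathSplit p q u v ℓ
    via-pq   : (w₁ : Path G (P ∖ j) u p) → length w₁ ≤ ℓ →
               (w₂ : Path G (P ∖ j) q v) → length w₂ ≤ ℓ → PathSplit p q u v ℓ
    via-qp   : (w₁ : Path G (P ∖ j) u q) → length w₁ ≤ ℓ →
               (w₂ : Path G (P ∖ j) p v) → length w₂ ≤ ℓ → PathSplit p q u v ℓ

  private
    step-pq : ∀ {p q u u′ v ℓ} → (p , q) ≡ (u , u′) → PathSplit p q u′ v ℓ → PathSplit p q u v (suc ℓ)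
    step-pq refl (avoiding w l)        = via-pq ε z≤n w (m≤n⇒m≤1+n l)
    step-pq refl (via-pq _ _ w₂ l₂)    = via-pq ε z≤n w₂ (m≤n⇒m≤1+n l₂)
    step-pq refl (via-qp _ _ w₂ l₂)    = avoiding w₂ (m≤n⇒m≤1+n l₂)

    step-qp : ∀ {p q u u′ v ℓ} → (p , q) ≡ (u′ , u) → PathSplit p q u′ v ℓ → PathSplit p q u v (suc ℓ)
    step-qp refl (avoiding w l)        = via-qp ε z≤n w (m≤n⇒m≤1+n l)
    step-qp refl (via-pq _ _ w₂ l₂)    = avoiding w₂ (m≤n⇒m≤1+n l₂)
    step-qp refl (via-qp _ _ w₂ l₂)    = via-qp ε z≤n w₂ (m≤n⇒m≤1+n l₂)

  path-split : ∀ {p q} → ends G j ≡ (p , q) → ∀ {u v} (w : Path G P u v) → PathSplit p q u v (length w)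
  path-split j≡pq ε = avoiding ε z≤n
  path-split j≡pq ((i , pi , o) ◅ w) with i ≟ j | path-split j≡pq w
  ... | no i≢j | avoiding w′ l       = avoiding ((i , (pi , i≢j) , o) ◅ w′) (s≤s l)
  ... | no i≢j | via-pq w₁ l₁ w₂ l₂  = via-pq ((i , (pi , i≢j) , o) ◅ w₁) (s≤s l₁) w₂ (m≤n⇒m≤1+n l₂)
  ... | no i≢j | via-qp w₁ l₁ w₂ l₂  = via-qp ((i , (pi , i≢j) , o) ◅ w₁) (s≤s l₁) w₂ (m≤n⇒m≤1+n l₂)
  ... | yes refl | split with o
  ...   | inj₁ o′ = step-pq (trans (sym j≡pq) o′) split
  ...   | inj₂ o′ = step-qp (trans (sym j≡pq) o′) split

module _ {n m : ℕ} (en : Fin (suc m) → Fin (suc n) × Fin (suc n)) (e : Fin (suc m))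
         (a≢b : proj₁ (en e) ≢ proj₂ (en e)) where

  private
    a b : Fin (suc n)
    a = proj₁ (en e)
    b = proj₂ (en e)
    G G/e : Multigraph
    G = graph en
    G/e = contractEdge en e a≢b
    merge : Fin (suc n) → Fin n
    merge = mergeVertex a b a≢b

  private
    merge-view : ∀ u →
      (u ≡ b × merge u ≡ punchOut {i = b} {j = a} (λ eq → a≢b (sym eq))) ⊎
      (Σ (u ≢ b) λ u≢b → merge u ≡ punchOut {i = b} {j = u} (λ eq → u≢b (sym eq)))
    merge-view u with u ≟ b
    ... | yes u≡b = inj₁ (u≡b , refl)
    ... | no u≢b  = inj₂ (u≢b , refl)

  merge-ends : merge a ≡ merge b
  merge-ends with merge-view a | merge-view b
  ... | inj₁ (a≡b , _) | _               = ⊥-elim (a≢b a≡b)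
  ... | _              | inj₂ (b≢b , _)  = ⊥-elim (b≢b refl)
  ... | inj₂ (_ , ea)  | inj₁ (_ , eb)   = trans ea (trans (punchOut-cong b refl) (sym eb))

  merge-fibre : ∀ u v → merge u ≡ merge v → u ≡ v ⊎ ((u ≡ a × v ≡ b) ⊎ (u ≡ b × v ≡ a))
  merge-fibre u v eq with merge-view u | merge-view v
  ... | inj₁ (u≡b , _) | inj₁ (v≡b , _) = inj₁ (trans u≡b (sym v≡b))
  ... | inj₁ (u≡b , eu) | inj₂ (v≢b , ev) =
        inj₂ (inj₂ (u≡b , sym (punchOut-injective _ (λ eq → v≢b (sym eq)) (trans (sym eu) (trans eq ev)))))
  ... | inj₂ (u≢b , eu) | inj₁ (v≡b , ev) =
        inj₂ (inj₁ (punchOut-injective (λ eq → u≢b (sym eq)) _ (trans (sym eu) (trans eq ev)) , v≡b))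
  ... | inj₂ (u≢b , eu) | inj₂ (v≢b , ev) =
        inj₁ (punchOut-injective (λ eq → u≢b (sym eq)) (λ eq → v≢b (sym eq)) (trans (sym eu) (trans eq ev)))

  merge-punchIn : ∀ x → merge (punchIn b x) ≡ x
  merge-punchIn x with merge-view (punchIn b x)
  ... | inj₁ (eq , _)   = ⊥-elim (punchInᵢ≢i b x eq)
  ... | inj₂ (_ , eq)   = trans eq (trans (punchOut-cong b refl) (punchOut-punchIn b))

  Path-merge : ∀ {Q : Fin (suc m) → Set} {T : Fin m → Set} → Q ⊆ Insert e T →
               ∀ {x y} → Path G Q x y → Path G/e T (merge x) (merge y)
  Path-merge {Q} {T} Q⊆ = gmap-collapsing merge step
    where
    ends-merge : ∀ {i x y} → en i ≡ (x , y) →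
                 (merge (proj₁ (en i)) , merge (proj₂ (en i))) ≡ (merge x , merge y)
    ends-merge o = cong (λ xy → merge (proj₁ xy) , merge (proj₂ xy)) o
    step : ∀ {x y} → Adjacent G Q x y → merge x ≡ merge y ⊎ Adjacent G/e T (merge x) (merge y)
    step (i , qi , o) with Q⊆ qi
    step (i , qi , inj₁ o) | inj₁ refl =
      inj₁ (trans (cong merge (sym (cong proj₁ o))) (trans merge-ends (cong merge (cong proj₂ o))))
    step (i , qi , inj₂ o) | inj₁ refl =
      inj₁ (trans (cong merge (sym (cong proj₂ o))) (trans (sym merge-ends) (cong merge (cong proj₁ o))))
    step (i , qi , inj₁ o) | inj₂ (j , refl , tj) = inj₂ (j , tj , inj₁ (ends-merge o))
    step (i , qi , inj₂ o) | inj₂ (j , refl , tj) = inj₂ (j , tj , inj₂ (ends-merge o))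

  Path-unmerge : ∀ {T : Fin m → Set} {Q : Fin (suc m) → Set} → Q e → (∀ j → T j → Q (punchIn e j)) →
                 ∀ {x y} → Path G/e T x y → ∀ u v → merge u ≡ x → merge v ≡ y → Path G Q u v
  Path-unmerge {Q = Q} qe h ε u v eu ev = across u v (trans eu (sym ev))
    where
    across : ∀ u v → merge u ≡ merge v → Path G Q u v
    across u v eq with merge-fibre u v eq
    ... | inj₁ refl = ε
    ... | inj₂ (inj₁ (refl , refl)) = (e , qe , inj₁ refl) ◅ ε
    ... | inj₂ (inj₂ (refl , refl)) = (e , qe , inj₂ refl) ◅ ε
  Path-unmerge qe h ((j , tj , inj₁ o) ◅ w) u v eu ev =
    Path-unmerge qe h ε u _ eu (cong proj₁ o) ◅◅
    ((punchIn e j , h j tj , inj₁ refl) ◅ Path-unmerge qe h w _ v (cong proj₂ o) ev)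
  Path-unmerge qe h ((j , tj , inj₂ o) ◅ w) u v eu ev =
    Path-unmerge qe h ε u _ eu (cong proj₂ o) ◅◅
    ((punchIn e j , h j tj , inj₂ refl) ◅ Path-unmerge qe h w _ v (cong proj₁ o) ev)

  IsTree-contractEdge⁻ : ∀ {T} → IsTree G (Insert e T) → IsTree G/e T
  IsTree-contractEdge⁻ {T} (conn , acyc) =
    (λ x y → subst₂ (Path G/e T) (merge-punchIn x) (merge-punchIn y)
                    (Path-merge (λ q → q) (conn (punchIn b x) (punchIn b y)))) ,
    λ j tj w → acyc (punchIn e j) (inj₂ (j , refl , tj))
      (Path-unmerge (inj₁ refl , λ eq → punchInᵢ≢i e j (sym eq))
                    (λ j′ (tj′ , ne) → inj₂ (j′ , refl , tj′) , λ eq → ne (punchIn-injective e j′ j eq))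
                    w _ _ refl refl)

  private
    PunchedIn∖⊆Insert∖ : ∀ {T j} → (PunchedIn e T ∖ punchIn e j) ⊆ Insert e (T ∖ j)
    PunchedIn∖⊆Insert∖ ((j′ , refl , tj′) , ne) = inj₂ (j′ , refl , (tj′ , λ eq → ne (cong (punchIn e) eq)))

  -- Merging a and b turns a path from a to b avoiding e into a closed walk of G/e.  Splitting
  -- its remainder at its first edge j either shows j lies on a cycle, or yields a shorter such path.
  module _ {T : Fin m → Set}
           (acyc : ∀ j → T j → ¬ Path G/e (T ∖ j) (proj₁ (ends G/e j)) (proj₂ (ends G/e j))) where

    private
      cycle-through : ∀ {x y} j → T j → (en (punchIn e j) ≡ (x , y)) ⊎ (en (punchIn e j) ≡ (y , x)) →
                      x ≡ a → Path G (PunchedIn e T ∖ punchIn e j) y b → ⊥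
      cycle-through {x} {y} j tj o x≡a w = acyc j tj (orient o)
        where
        back : Path G/e (T ∖ j) (merge y) (merge x)
        back = subst (Path G/e (T ∖ j) (merge y)) (trans (sym merge-ends) (cong merge (sym x≡a)))
                     (Path-merge PunchedIn∖⊆Insert∖ w)
        orient : (en (punchIn e j) ≡ (x , y)) ⊎ (en (punchIn e j) ≡ (y , x)) →
                 Path G/e (T ∖ j) (proj₁ (ends G/e j)) (proj₂ (ends G/e j))
        orient (inj₁ o) = subst₂ (Path G/e (T ∖ j)) (cong (λ xy → merge (proj₁ xy)) (sym o))
                                 (cong (λ xy → merge (proj₂ xy)) (sym o)) (Path-reverse back)
        orient (inj₂ o) = subst₂ (Path G/e (T ∖ j)) (cong (λ xy → merge (proj₁ xy)) (sym o))
                                 (cong (λ xy → merge (proj₂ xy)) (sym o)) back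

      shorter : ∀ {N i x} (w : Path G (PunchedIn e T ∖ i) x b) → ∀ {ℓ} → length w ≤ ℓ → ℓ ≤ N →
                Σ (Path G (PunchedIn e T) x b) λ w′ → length w′ ≤ N
      shorter w l l′ = Path-mono proj₁ w , subst (_≤ _) (sym (length-map _ w)) (≤-trans l l′)

    no-path-avoiding-e : ∀ N {x} (w : Path G (PunchedIn e T) x b) → x ≡ a → length w ≤ N → ⊥
    no-path-avoiding-e N ε x≡a _ = a≢b (sym x≡a)
    no-path-avoiding-e (suc N) ((_ , (j , refl , tj) , inj₁ o) ◅ w) x≡a (s≤s l)
      with path-split G (PunchedIn e T) (punchIn e j) o w
    ... | avoiding w₂ _   = cycle-through j tj (inj₁ o) x≡a w₂
    ... | via-pq _ _ w₂ _ = cycle-through j tj (inj₁ o) x≡a w₂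
    ... | via-qp _ _ w₂ l₂ = let (w′ , l′) = shorter w₂ l₂ l in no-path-avoiding-e N w′ x≡a l′
    no-path-avoiding-e (suc N) ((_ , (j , refl , tj) , inj₂ o) ◅ w) x≡a (s≤s l)
      with path-split G (PunchedIn e T) (punchIn e j) o w
    ... | avoiding w₂ _   = cycle-through j tj (inj₂ o) x≡a w₂
    ... | via-pq _ _ w₂ l₂ = let (w′ , l′) = shorter w₂ l₂ l in no-path-avoiding-e N w′ x≡a l′
    ... | via-qp _ _ w₂ _ = cycle-through j tj (inj₂ o) x≡a w₂

  IsTree-contractEdge⁺ : ∀ {T} → IsTree G/e T → IsTree G (Insert e T)
  IsTree-contractEdge⁺ {T} (conn , acyc) =
    (λ u v → Path-unmerge (inj₁ refl) (λ j tj → inj₂ (j , refl , tj)) (conn (merge u) (merge v))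
                          u v refl refl) ,
    acyc′
    where
    acyc′ : ∀ i → Insert e T i → ¬ Path G (Insert e T ∖ i) (proj₁ (en i)) (proj₂ (en i))
    acyc′ _ (inj₂ (j , refl , tj)) w =
      acyc j tj (Path-merge (λ { (inj₁ eq , _) → inj₁ eq ; (inj₂ p , ne) → PunchedIn∖⊆Insert∖ (p , ne) }) w)
    acyc′ _ (inj₁ refl) w =
      no-path-avoiding-e acyc _ (Path-mono (λ { (inj₁ eq , ne) → ⊥-elim (ne eq) ; (inj₂ p , _) → p }) w)
                         refl ≤-refl

  HasTreeCount-contractEdge : ∀ {t} → HasTreeCount G/e t →
                              HasCardinality (λ S → IsSpanningTree G S × lookup S e ≡ true) t
  HasTreeCount-contractEdge = HasTreeCount-insertAt en e true (Insert e) (λ T → ∈insertAt-true T e)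
                                IsTree-contractEdge⁺ IsTree-contractEdge⁻

deletion-contraction : ∀ {n m} (en : Fin (suc m) → Fin (suc n) × Fin (suc n)) e
                       (a≢b : proj₁ (en e) ≢ proj₂ (en e)) {t u} →
                       HasTreeCount (contractEdge en e a≢b) t → HasTreeCount (deleteEdge en e) u →
                       HasTreeCount (graph en) (t + u)
deletion-contraction en e a≢b τ/e τ-e =
  HasCardinality-⊎ split (λ _ → proj₁) (λ _ → proj₁)
    (λ _ (_ , S[e]≡true) (_ , S[e]≡false) → true≢false (trans (sym S[e]≡true) S[e]≡false))
    (HasTreeCount-contractEdge en e a≢b τ/e) (HasTreeCount-deleteEdge en e τ-e)
  where
  true≢false : true ≢ false
  true≢false ()
  split : ∀ S → IsSpanningTree (graph en) S →
          (IsSpanningTree (graph en) S × lookup S e ≡ true) ⊎ (IsSpanningTree (graph en) S × lookup S e ≡ false)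
  split S tree with lookup S e
  ... | true  = inj₁ (tree , refl)
  ... | false = inj₂ (tree , refl)

IsSpanningTree-avoids-loop : ∀ {G S j} → IsSpanningTree G S → proj₁ (ends G j) ≡ proj₂ (ends G j) →
                             lookup S j ≡ false
IsSpanningTree-avoids-loop {G} {S} {j} (_ , acyc) loop with lookup S j in S[j]
... | false = refl
... | true  = ⊥-elim (acyc j (lookup⇒[]= j S S[j]) (subst (Reach G (S - j) _) loop ε))

HasTreeCount-deleteLoop : ∀ {n m} (en : Fin (suc m) → Fin n × Fin n) j → proj₁ (en j) ≡ proj₂ (en j) →
                          ∀ {c} → HasTreeCount (deleteEdge en j) c → HasTreeCount (graph en) c
HasTreeCount-deleteLoop en j loop τ-j =
  HasCardinality-cong (proj₁ , λ tree → tree , IsSpanningTree-avoids-loop tree loop)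
                      (HasTreeCount-deleteEdge en j τ-j)

-- Adding a common neighbour of the ends of an edge

addCommonNeighbour : ∀ {k m} → (Fin m → Fin k × Fin k) → Fin k → Fin k →
                     Fin (suc (suc m)) → Fin (suc k) × Fin (suc k)
addCommonNeighbour en a b zero          = (suc a , zero)
addCommonNeighbour en a b (suc zero)    = (zero , suc b)
addCommonNeighbour en a b (suc (suc j)) = (suc (proj₁ (en j)) , suc (proj₂ (en j)))

module _ {k m : ℕ} (en : Fin m → Fin k × Fin k) (a b : Fin k) where

  private
    G′ : Fin (suc (suc m)) → Fin (suc k) × Fin (suc k)
    G′ = addCommonNeighbour en a b
    G D : Multigraph
    G = graph en
    D = deleteEdge G′ zero

    retract : Fin (suc k) → Fin k
    retract zero    = b
    retract (suc x) = x

    shift-ends : ∀ {j x y} → en j ≡ (x , y) → G′ (suc (suc j)) ≡ (suc x , suc y)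
    shift-ends o = cong (λ xy → suc (proj₁ xy) , suc (proj₂ xy)) o

    retract-ends : ∀ {x y} j → G′ (suc (suc j)) ≡ (x , y) → en j ≡ (retract x , retract y)
    retract-ends j refl = refl

    Path-shift : ∀ {Q : Fin m → Set} {Q′ : Fin (suc m) → Set} → (∀ j → Q j → Q′ (suc j)) →
                 ∀ {x y} → Path G Q x y → Path D Q′ (suc x) (suc y)
    Path-shift h = kleisliStar suc λ { (j , qj , inj₁ o) → (suc j , h j qj , inj₁ (shift-ends o)) ◅ ε
                                     ; (j , qj , inj₂ o) → (suc j , h j qj , inj₂ (shift-ends o)) ◅ ε }

    Path-retract : ∀ {Q : Fin (suc m) → Set} {Q′ : Fin m → Set} → (∀ j → Q (suc j) → Q′ j) →
                   ∀ {x y} → Path D Q x y → Path G Q′ (retract x) (retract y)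
    Path-retract {Q} {Q′} h = gmap-collapsing retract step
      where
      step : ∀ {x y} → Adjacent D Q x y → retract x ≡ retract y ⊎ Adjacent G Q′ (retract x) (retract y)
      step (zero , _ , inj₁ refl)  = inj₁ refl
      step (zero , _ , inj₂ refl)  = inj₁ refl
      step (suc j , q , inj₁ o) = inj₂ (j , h j q , inj₁ (retract-ends j o))
      step (suc j , q , inj₂ o) = inj₂ (j , h j q , inj₂ (retract-ends j o))

    pendant : ∀ {Q : Fin (suc m) → Set} → Q zero → Adjacent D Q zero (suc b)
    pendant q = zero , q , inj₁ refl

    Path-from-isolated : ∀ {Q : Fin (suc m) → Set} → ¬ Q zero → ∀ {v} → Path D Q zero v → v ≡ zero
    Path-from-isolated ¬q ε = refl
    Path-from-isolated ¬q ((zero , q , _) ◅ _) = ⊥-elim (¬q q)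
    Path-from-isolated ¬q ((suc j , q , inj₁ ()) ◅ _)
    Path-from-isolated ¬q ((suc j , q , inj₂ ()) ◅ _)

  IsTree-addPendant⁺ : ∀ {T} → IsTree G T → IsTree D (Insert zero T)
  IsTree-addPendant⁺ {T} (conn , acyc) = conn′ , acyc′
    where
    lift : ∀ j → T j → Insert zero T (suc j)
    lift j tj = inj₂ (j , refl , tj)
    conn′ : ∀ u v → Path D (Insert zero T) u v
    conn′ zero    zero    = ε
    conn′ zero    (suc y) = pendant (inj₁ refl) ◅ Path-shift lift (conn b y)
    conn′ (suc x) zero    = Path-shift lift (conn x b) ◅◅ (Adjacent-sym (pendant (inj₁ refl)) ◅ ε)
    conn′ (suc x) (suc y) = Path-shift lift (conn x y)
    acyc′ : ∀ i → Insert zero T i → ¬ Path D (Insert zero T ∖ i) (proj₁ (ends D i)) (proj₂ (ends D i))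
    acyc′ _ (inj₁ refl) w with Path-from-isolated (λ (_ , ne) → ne refl) w
    ... | ()
    acyc′ _ (inj₂ (j , refl , tj)) w =
      acyc j tj (Path-retract (λ { _ (inj₂ (_ , refl , tj′) , ne) → tj′ , λ eq → ne (cong suc eq) }) w)

  IsTree-addPendant⁻ : ∀ {T} → IsTree D (Insert zero T) → IsTree G T
  IsTree-addPendant⁻ {T} (conn , acyc) =
    (λ u v → Path-retract (λ { _ (inj₂ (_ , refl , tj)) → tj }) (conn (suc u) (suc v))) ,
    λ j tj w → acyc (suc j) (inj₂ (j , refl , tj))
      (Path-shift (λ j′ (tj′ , ne) → inj₂ (j′ , refl , tj′) , λ eq → ne (suc-injective eq)) w)

  IsTree-contains-pendant : ∀ {P} → IsTree D P → P zero
  IsTree-contains-pendant (conn , _) with conn zero (suc b)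
  ... | (zero , q , _) ◅ _ = q
  ... | (suc j , q , inj₁ ()) ◅ _
  ... | (suc j , q , inj₂ ()) ◅ _

  HasTreeCount-addCommonNeighbour-delete : ∀ {c} → HasTreeCount G c → HasTreeCount D c
  HasTreeCount-addCommonNeighbour-delete τ =
    HasCardinality-cong (proj₁ , λ tree → tree , []=⇒lookup (IsTree-contains-pendant (IsSpanningTree⇒IsTree tree)))
      (HasTreeCount-insertAt (ends D) zero true (Insert zero) (λ T → ∈insertAt-true T zero)
         IsTree-addPendant⁺ IsTree-addPendant⁻ τ)

HasTreeCount-addCommonNeighbour-contract :
  ∀ {k m} (en : Fin (suc m) → Fin (suc k) × Fin (suc k)) e (a≢b : proj₁ (en e) ≢ proj₂ (en e)) {t u} →
  HasTreeCount (contractEdge en e a≢b) t → HasTreeCount (deleteEdge en e) u →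
  HasTreeCount (contractEdge (addCommonNeighbour en (proj₁ (en e)) (proj₂ (en e))) zero (λ ())) (2 * t + u)
HasTreeCount-addCommonNeighbour-contract en e a≢b {t} {u} τ/e τ-e =
  subst (HasTreeCount G′/zero) t+[t+u]≡2t+u
    (deletion-contraction (ends G′/zero) zero a≢b
      (HasTreeCount-deleteLoop (ends (contractEdge (ends G′/zero) zero a≢b)) e (merge-ends en e a≢b) τ/e)
      (deletion-contraction en e a≢b τ/e τ-e))
  where
  G′/zero : Multigraph
  G′/zero = contractEdge (addCommonNeighbour en (proj₁ (en e)) (proj₂ (en e))) zero (λ ())
  t+[t+u]≡2t+u : t + (t + u) ≡ 2 * t + u
  t+[t+u]≡2t+u = trans (sym (+-assoc t t u)) (cong (λ z → (t + z) + u) (sym (+-identityʳ t)))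

addCommonNeighbour-simple : ∀ {k m} (en : Fin m → Fin k × Fin k) {a b} → a ≢ b →
                            IsSimple en → IsSimple (addCommonNeighbour en a b)
addCommonNeighbour-simple {k} {m} en {a} {b} a≢b (loopless , distinct) = loopless′ , distinct′
  where
  G′ : Fin (suc (suc m)) → Fin (suc k) × Fin (suc k)
  G′ = addCommonNeighbour en a b
  loopless′ : ∀ j → proj₁ (G′ j) ≢ proj₂ (G′ j)
  loopless′ zero ()
  loopless′ (suc zero) ()
  loopless′ (suc (suc j)) eq = loopless j (suc-injective eq)
  distinct′ : ∀ i j → SameEnds (G′ i) (G′ j) → i ≡ j
  distinct′ zero          zero          _                = refl
  distinct′ zero          (suc zero)    (inj₁ (() , _))
  distinct′ zero          (suc zero)    (inj₂ (eq , _))  = ⊥-elim (a≢b (suc-injective eq))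
  distinct′ zero          (suc (suc j)) (inj₁ (_ , ()))
  distinct′ zero          (suc (suc j)) (inj₂ (_ , ()))
  distinct′ (suc zero)    zero          (inj₁ (() , _))
  distinct′ (suc zero)    zero          (inj₂ (_ , eq))  = ⊥-elim (a≢b (suc-injective (sym eq)))
  distinct′ (suc zero)    (suc zero)    _                = refl
  distinct′ (suc zero)    (suc (suc j)) (inj₁ (() , _))
  distinct′ (suc zero)    (suc (suc j)) (inj₂ (() , _))
  distinct′ (suc (suc i)) zero          (inj₁ (_ , ()))
  distinct′ (suc (suc i)) zero          (inj₂ (() , _))
  distinct′ (suc (suc i)) (suc zero)    (inj₁ (() , _))
  distinct′ (suc (suc i)) (suc zero)    (inj₂ (_ , ()))
  distinct′ (suc (suc i)) (suc (suc j)) (inj₁ (e₁ , e₂)) =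
    cong (λ z → suc (suc z)) (distinct i j (inj₁ (suc-injective e₁ , suc-injective e₂)))
  distinct′ (suc (suc i)) (suc (suc j)) (inj₂ (e₁ , e₂)) =
    cong (λ z → suc (suc z)) (distinct i j (inj₂ (suc-injective e₁ , suc-injective e₂)))

-- Planarity

Star-stable : ∀ {B : Set} {R : B → B → Set} (Z : B → Set) → (∀ {x y} → R x y → Z x → Z y) →
              ∀ {x y} → Star R x y → Z x → Z y
Star-stable Z h ε        zx = zx
Star-stable Z h (r ◅ rs) zx = Star-stable Z h rs (h r zx)

Star-stable⁻ : ∀ {B : Set} {R : B → B → Set} (Z : B → Set) → (∀ {x y} → R x y → Z y → Z x) →
               ∀ {x y} → Star R x y → Z y → Z x
Star-stable⁻ Z h ε        zy = zy
Star-stable⁻ Z h (r ◅ rs) zy = h r (Star-stable⁻ Z h rs zy)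

module _ {A B : Set} {R : A → A → Set} {R′ : B → B → Set} (ι : A → B) (π : B → A)
         (π-step : ∀ {x y} → R′ x y → π x ≡ π y ⊎ R (π x) (π y)) (π∘ι : ∀ x → π (ι x) ≡ x)
         (ι-step : ∀ {x y} → R x y → Star R′ (ι x) (ι y)) where

  private
    separated : ∀ {c} (r : Vec A c) → (∀ i j → Star R (lookup r i) (lookup r j) → i ≡ j) →
                ∀ i j → Star R′ (lookup (map ι r) i) (lookup (map ι r) j) → i ≡ j
    separated r sep i j w =
      sep i j (subst₂ (Star R) (trans (cong π (lookup-map i ι r)) (π∘ι _))
                               (trans (cong π (lookup-map j ι r)) (π∘ι _)) (gmap-collapsing π π-step w))

    covered : ∀ {c} (r : Vec A c) → (∀ x → ∃ λ i → Star R (lookup r i) x) →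
              ∀ {x y} → Star R′ (ι x) y → ∃ λ i → Star R′ (lookup (map ι r) i) y
    covered r cov {x} w with cov x
    ... | (i , w₀) = i , subst (λ z → Star R′ z _) (sym (lookup-map i ι r)) (kleisliStar ι ι-step w₀ ◅◅ w)

  NumClasses-retract : ∀ {c} → (∀ y → ∃ λ x → Star R′ (ι x) y) →
                       NumClasses (Star R) c → NumClasses (Star R′) c
  NumClasses-retract reach (r , sep , cov) = map ι r , separated r sep , λ y → covered r cov (proj₂ (reach y))

  NumClasses-retract-suc : ∀ {c} (z : B) (Z : B → Set) → Z z →
    (∀ {x y} → R′ x y → Z x → Z y) → (∀ {x y} → R′ x y → Z y → Z x) → (∀ x → ¬ Z (ι x)) →
    (∀ y → (∃ λ x → Star R′ (ι x) y) ⊎ Star R′ z y) →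
    NumClasses (Star R) c → NumClasses (Star R′) (suc c)
  NumClasses-retract-suc z Z zz Z-stable Z-stable⁻ ¬Zι reach (r , sep , cov) = (z ∷ map ι r) , sep′ , cov′
    where
    sep′ : ∀ i j → Star R′ (lookup (z ∷ map ι r) i) (lookup (z ∷ map ι r) j) → i ≡ j
    sep′ zero    zero    _ = refl
    sep′ zero    (suc j) w = ⊥-elim (¬Zι _ (subst Z (lookup-map j ι r) (Star-stable Z Z-stable w zz)))
    sep′ (suc i) zero    w = ⊥-elim (¬Zι _ (subst Z (lookup-map i ι r) (Star-stable⁻ Z Z-stable⁻ w zz)))
    sep′ (suc i) (suc j) w = cong suc (separated r sep i j w)
    cov′ : ∀ y → ∃ λ i → Star R′ (lookup (z ∷ map ι r) i) y
    cov′ y with reach y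
    ... | inj₂ w = zero , w
    ... | inj₁ (x , w) with covered r cov w
    ...   | (i , w′) = suc i , w′

flip-involutive : ∀ {m} (d : Dart m) → flip (flip d) ≡ d
flip-involutive (j , false) = refl
flip-involutive (j , true)  = refl

-- Dart xʸ lies at x on an edge towards y; v is the new vertex.  The darts aᵛ and bᵛ are inserted
-- into the rotations at a and b right after aᵇ and right before bᵃ, and v gets the rotation (vᵃ vᵇ).
-- So v is placed inside a face bordering e, which it splits in two: the new system has one more
-- vertex orbit and one more face, and the same components.
module AddCommonNeighbourRotation
  {k m : ℕ} (en : Fin (suc m) → Fin (suc k) × Fin (suc k)) (e : Fin (suc m))
  (a≢b : proj₁ (en e) ≢ proj₂ (en e))
  (σ : Dart (suc m) → Dart (suc m)) (σ-bijective : Bijective _≡_ _≡_ σ)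
  (σ-tail : ∀ d → tail en (σ d) ≡ tail en d) where
  a b : Fin (suc k)
  a = proj₁ (en e)
  b = proj₂ (en e)
  G′ : Fin (suc (suc (suc m))) → Fin (suc (suc k)) × Fin (suc (suc k))
  G′ = addCommonNeighbour en a b
  OldDart NewDart : Set
  OldDart = Dart (suc m)
  NewDart = Dart (suc (suc (suc m)))

  σ-injective : ∀ {x y} → σ x ≡ σ y → x ≡ y
  σ-injective = proj₁ σ-bijective
  σ⁻¹ : OldDart → OldDart
  σ⁻¹ y = proj₁ (proj₂ σ-bijective y)
  σ∘σ⁻¹ : ∀ y → σ (σ⁻¹ y) ≡ y
  σ∘σ⁻¹ y = proj₂ (proj₂ σ-bijective y) refl

  aᵇ bᵃ pred-bᵃ succ-aᵇ : OldDart
  aᵇ = (e , false)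
  bᵃ = (e , true)
  pred-bᵃ = σ⁻¹ bᵃ
  succ-aᵇ = σ aᵇ

  _≟ᵈ_ : (x y : OldDart) → Dec (x ≡ y)
  _≟ᵈ_ = ≡-dec _≟_ _≟ᵇ_

  old : OldDart → NewDart
  old (j , s) = (suc (suc j) , s)

  old-injective : ∀ {x y} → old x ≡ old y → x ≡ y
  old-injective {j , s} {j′ , .s} refl = refl

  aᵛ vᵃ vᵇ bᵛ : NewDart
  aᵛ = (zero , false)
  vᵃ = (zero , true)
  vᵇ = (suc zero , false)
  bᵛ = (suc zero , true)

  tail-pred-bᵃ : tail en pred-bᵃ ≡ b
  tail-pred-bᵃ = trans (sym (σ-tail pred-bᵃ)) (cong (tail en) (σ∘σ⁻¹ bᵃ))
  tail-succ-aᵇ : tail en succ-aᵇ ≡ a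
  tail-succ-aᵇ = σ-tail aᵇ
  pred-bᵃ≢aᵇ : pred-bᵃ ≢ aᵇ
  pred-bᵃ≢aᵇ eq = a≢b (sym (trans (sym tail-pred-bᵃ) (cong (tail en) eq)))
  succ-aᵇ≢bᵃ : succ-aᵇ ≢ bᵃ
  succ-aᵇ≢bᵃ eq = a≢b (trans (sym tail-succ-aᵇ) (cong (tail en) eq))
  flip-pred-bᵃ≢bᵃ : flip pred-bᵃ ≢ bᵃ
  flip-pred-bᵃ≢bᵃ eq = pred-bᵃ≢aᵇ (trans (sym (flip-involutive pred-bᵃ)) (cong flip eq))
  σ-pred-bᵃ : σ pred-bᵃ ≡ bᵃ
  σ-pred-bᵃ = σ∘σ⁻¹ bᵃ

  σ′-old : OldDart → NewDart
  σ′-old d with d ≟ᵈ aᵇ | d ≟ᵈ pred-bᵃ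
  ... | yes _ | _ = aᵛ
  ... | no _ | yes _ = bᵛ
  ... | no _ | no _ = old (σ d)

  σ′-old-view : ∀ d → (d ≡ aᵇ × σ′-old d ≡ aᵛ) ⊎
                      ((d ≢ aᵇ × d ≡ pred-bᵃ × σ′-old d ≡ bᵛ) ⊎ (d ≢ aᵇ × d ≢ pred-bᵃ × σ′-old d ≡ old (σ d)))
  σ′-old-view d with d ≟ᵈ aᵇ | d ≟ᵈ pred-bᵃ
  ... | yes x | _ = inj₁ (x , refl)
  ... | no x | yes y = inj₂ (inj₁ (x , y , refl))
  ... | no x | no y = inj₂ (inj₂ (x , y , refl))

  σ′ : NewDart → NewDart
  σ′ (zero , false) = old succ-aᵇ
  σ′ (zero , true) = vᵇ
  σ′ (suc zero , false) = vᵃ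
  σ′ (suc zero , true) = old bᵃ
  σ′ (suc (suc j) , s) = σ′-old (j , s)

  σ′∘old : ∀ d → σ′ (old d) ≡ σ′-old d
  σ′∘old (j , s) = refl

  σ′-old-aᵇ : σ′-old aᵇ ≡ aᵛ
  σ′-old-aᵇ with σ′-old-view aᵇ
  ... | inj₁ (_ , q) = q
  ... | inj₂ (inj₁ (ne , _)) = ⊥-elim (ne refl)
  ... | inj₂ (inj₂ (ne , _)) = ⊥-elim (ne refl)

  σ′-old-pred-bᵃ : σ′-old pred-bᵃ ≡ bᵛ
  σ′-old-pred-bᵃ with σ′-old-view pred-bᵃ
  ... | inj₁ (eq , _) = ⊥-elim (pred-bᵃ≢aᵇ eq)
  ... | inj₂ (inj₁ (_ , _ , q)) = q
  ... | inj₂ (inj₂ (_ , ne , _)) = ⊥-elim (ne refl)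

  aᵇ↦aᵛ : aᵛ ≡ σ′ (old aᵇ)
  aᵇ↦aᵛ = sym σ′-old-aᵇ

  pred-bᵃ↦bᵛ : bᵛ ≡ σ′ (old pred-bᵃ)
  pred-bᵃ↦bᵛ = sym σ′-old-pred-bᵃ

  σ′⁻¹-old : OldDart → NewDart
  σ′⁻¹-old y with y ≟ᵈ bᵃ | y ≟ᵈ succ-aᵇ
  ... | yes _ | _ = bᵛ
  ... | no _ | yes _ = aᵛ
  ... | no _ | no _ = old (σ⁻¹ y)

  σ′⁻¹-old-view : ∀ y → (y ≡ bᵃ × σ′⁻¹-old y ≡ bᵛ) ⊎
                        ((y ≢ bᵃ × y ≡ succ-aᵇ × σ′⁻¹-old y ≡ aᵛ) ⊎ (y ≢ bᵃ × y ≢ succ-aᵇ × σ′⁻¹-old y ≡ old (σ⁻¹ y)))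
  σ′⁻¹-old-view y with y ≟ᵈ bᵃ | y ≟ᵈ succ-aᵇ
  ... | yes x | _ = inj₁ (x , refl)
  ... | no x | yes z = inj₂ (inj₁ (x , z , refl))
  ... | no x | no z = inj₂ (inj₂ (x , z , refl))

  σ′⁻¹ : NewDart → NewDart
  σ′⁻¹ (zero , false) = old aᵇ
  σ′⁻¹ (zero , true) = vᵇ
  σ′⁻¹ (suc zero , false) = vᵃ
  σ′⁻¹ (suc zero , true) = old pred-bᵃ
  σ′⁻¹ (suc (suc j) , s) = σ′⁻¹-old (j , s)

  σ′⁻¹∘old : ∀ d → σ′⁻¹ (old d) ≡ σ′⁻¹-old d
  σ′⁻¹∘old (j , s) = refl

  σ′⁻¹∘σ′ : ∀ x → σ′⁻¹ (σ′ x) ≡ x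
  σ′⁻¹∘σ′ (zero , false) with σ′⁻¹-old-view succ-aᵇ
  ... | inj₁ (eq , _) = ⊥-elim (succ-aᵇ≢bᵃ eq)
  ... | inj₂ (inj₁ (_ , _ , q)) = trans (σ′⁻¹∘old succ-aᵇ) q
  ... | inj₂ (inj₂ (_ , ne , _)) = ⊥-elim (ne refl)
  σ′⁻¹∘σ′ (zero , true) = refl
  σ′⁻¹∘σ′ (suc zero , false) = refl
  σ′⁻¹∘σ′ (suc zero , true) with σ′⁻¹-old-view bᵃ
  ... | inj₁ (_ , q) = trans (σ′⁻¹∘old bᵃ) q
  ... | inj₂ (inj₁ (ne , _)) = ⊥-elim (ne refl)
  ... | inj₂ (inj₂ (ne , _)) = ⊥-elim (ne refl)
  σ′⁻¹∘σ′ (suc (suc j) , s) with σ′-old-view (j , s)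
  ... | inj₁ (refl , q) = cong σ′⁻¹ q
  ... | inj₂ (inj₁ (_ , refl , q)) = cong σ′⁻¹ q
  ... | inj₂ (inj₂ (n₁ , n₂ , q)) with σ′⁻¹-old-view (σ (j , s))
  ...   | inj₁ (eq , _) = ⊥-elim (n₂ (σ-injective (trans eq (sym σ-pred-bᵃ))))
  ...   | inj₂ (inj₁ (_ , eq , _)) = ⊥-elim (n₁ (σ-injective eq))
  ...   | inj₂ (inj₂ (_ , _ , q′)) =
          trans (cong σ′⁻¹ q) (trans (σ′⁻¹∘old (σ (j , s)))
            (trans q′ (cong old (σ-injective (σ∘σ⁻¹ (σ (j , s)))))))

  σ′∘σ′⁻¹ : ∀ y → σ′ (σ′⁻¹ y) ≡ y
  σ′∘σ′⁻¹ (zero , false) = trans (σ′∘old aᵇ) σ′-old-aᵇ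
  σ′∘σ′⁻¹ (zero , true) = refl
  σ′∘σ′⁻¹ (suc zero , false) = refl
  σ′∘σ′⁻¹ (suc zero , true) = trans (σ′∘old pred-bᵃ) σ′-old-pred-bᵃ
  σ′∘σ′⁻¹ (suc (suc j) , s) with σ′⁻¹-old-view (j , s)
  ... | inj₁ (refl , q) = cong σ′ q
  ... | inj₂ (inj₁ (_ , refl , q)) = cong σ′ q
  ... | inj₂ (inj₂ (n₁ , n₂ , q)) with σ′-old-view (σ⁻¹ (j , s))
  ...   | inj₁ (eq , _) = ⊥-elim (n₂ (trans (sym (σ∘σ⁻¹ (j , s))) (cong σ eq)))
  ...   | inj₂ (inj₁ (_ , eq , _)) = ⊥-elim (n₁ (trans (sym (σ∘σ⁻¹ (j , s))) (trans (cong σ eq) σ-pred-bᵃ)))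
  ...   | inj₂ (inj₂ (_ , _ , q′)) =
          trans (cong σ′ q) (trans (σ′∘old (σ⁻¹ (j , s))) (trans q′ (cong old (σ∘σ⁻¹ (j , s)))))

  σ′-bijective : Bijective _≡_ _≡_ σ′
  σ′-bijective = (λ {x} {y} eq → trans (sym (σ′⁻¹∘σ′ x)) (trans (cong σ′⁻¹ eq) (σ′⁻¹∘σ′ y))) ,
         λ y → σ′⁻¹ y , λ { refl → σ′∘σ′⁻¹ y }

  tail-old : ∀ d → tail G′ (old d) ≡ suc (tail en d)
  tail-old (j , false) = refl
  tail-old (j , true) = refl

  σ′-tail : ∀ d → tail G′ (σ′ d) ≡ tail G′ d
  σ′-tail (zero , false) = trans (tail-old succ-aᵇ) (cong suc tail-succ-aᵇ)
  σ′-tail (zero , true) = refl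
  σ′-tail (suc zero , false) = refl
  σ′-tail (suc zero , true) = refl
  σ′-tail (suc (suc j) , s) with σ′-old-view (j , s)
  ... | inj₁ (refl , q) = trans (cong (tail G′) q) (sym (tail-old aᵇ))
  ... | inj₂ (inj₁ (_ , refl , q)) = trans (cong (tail G′) q) (sym (trans (tail-old pred-bᵃ) (cong suc tail-pred-bᵃ)))
  ... | inj₂ (inj₂ (_ , _ , q)) =
        trans (cong (tail G′) q)
              (trans (tail-old (σ (j , s))) (trans (cong suc (σ-tail (j , s))) (sym (tail-old (j , s)))))

  Rot : OldDart → OldDart → Set
  Rot x y = y ≡ σ x
  Rot′ : NewDart → NewDart → Set
  Rot′ x y = y ≡ σ′ x

  old-Rot : ∀ {x y} → Rot x y → Star Rot′ (old x) (old y)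
  old-Rot {x} refl with σ′-old-view x
  ... | inj₁ (refl , q) = sym (trans (σ′∘old aᵇ) q) ◅ (refl ◅ ε)
  ... | inj₂ (inj₁ (_ , refl , q)) = sym (trans (σ′∘old pred-bᵃ) q) ◅ (cong old σ-pred-bᵃ ◅ ε)
  ... | inj₂ (inj₂ (_ , _ , q)) = sym (trans (σ′∘old x) q) ◅ ε

  old-Rot⋆ : ∀ {x y} → Star Rot x y → Star Rot′ (old x) (old y)
  old-Rot⋆ = kleisliStar old old-Rot

  module _ (σ-transitive : ∀ d d′ → tail en d ≡ tail en d′ → Star Rot d d′) where
    σ′-transitive : ∀ d d′ → tail G′ d ≡ tail G′ d′ → Star Rot′ d d′
    σ′-transitive (zero , false) (zero , false) h = ε
    σ′-transitive (zero , false) (zero , true) ()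
    σ′-transitive (zero , false) (suc zero , false) ()
    σ′-transitive (zero , false) (suc zero , true) h = ⊥-elim (a≢b (suc-injective h))
    σ′-transitive (zero , false) (suc (suc j) , s) h =
      refl ◅ old-Rot⋆ (σ-transitive succ-aᵇ (j , s)
                        (trans tail-succ-aᵇ (suc-injective (trans h (tail-old (j , s))))))
    σ′-transitive (zero , true) (zero , false) ()
    σ′-transitive (zero , true) (zero , true) h = ε
    σ′-transitive (zero , true) (suc zero , false) h = refl ◅ ε
    σ′-transitive (zero , true) (suc zero , true) ()
    σ′-transitive (zero , true) (suc (suc j) , s) h = ⊥-elim (0≢1+n (trans h (tail-old (j , s))))
    σ′-transitive (suc zero , false) (zero , false) ()
    σ′-transitive (suc zero , false) (zero , true) h = refl ◅ ε
    σ′-transitive (suc zero , false) (suc zero , false) h = ε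
    σ′-transitive (suc zero , false) (suc zero , true) ()
    σ′-transitive (suc zero , false) (suc (suc j) , s) h = ⊥-elim (0≢1+n (trans h (tail-old (j , s))))
    σ′-transitive (suc zero , true) (zero , false) h = ⊥-elim (a≢b (sym (suc-injective h)))
    σ′-transitive (suc zero , true) (zero , true) ()
    σ′-transitive (suc zero , true) (suc zero , false) ()
    σ′-transitive (suc zero , true) (suc zero , true) h = ε
    σ′-transitive (suc zero , true) (suc (suc j) , s) h =
      refl ◅ old-Rot⋆ (σ-transitive bᵃ (j , s) (suc-injective (trans h (tail-old (j , s)))))
    σ′-transitive (suc (suc j) , s) (zero , false) h =
      old-Rot⋆ (σ-transitive (j , s) aᵇ (suc-injective (trans (sym (tail-old (j , s))) h))) ◅◅
      (aᵇ↦aᵛ ◅ ε)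
    σ′-transitive (suc (suc j) , s) (zero , true) h = ⊥-elim (0≢1+n (sym (trans (sym (tail-old (j , s))) h)))
    σ′-transitive (suc (suc j) , s) (suc zero , false) h = ⊥-elim (0≢1+n (sym (trans (sym (tail-old (j , s))) h)))
    σ′-transitive (suc (suc j) , s) (suc zero , true) h =
      old-Rot⋆ (σ-transitive (j , s) pred-bᵃ
                 (trans (suc-injective (trans (sym (tail-old (j , s))) h)) (sym tail-pred-bᵃ))) ◅◅
      (pred-bᵃ↦bᵛ ◅ ε)
    σ′-transitive (suc (suc j) , s) (suc (suc j′) , s′) h =
      old-Rot⋆ (σ-transitive (j , s) (j′ , s′)
                 (suc-injective (trans (sym (tail-old (j , s))) (trans h (tail-old (j′ , s′))))))

  πᵛ : NewDart → OldDart
  πᵛ (zero , false) = aᵇ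
  πᵛ (zero , true) = aᵇ
  πᵛ (suc zero , false) = aᵇ
  πᵛ (suc zero , true) = pred-bᵃ
  πᵛ (suc (suc j) , s) = (j , s)

  πᵛ∘old : ∀ d → πᵛ (old d) ≡ d
  πᵛ∘old (j , s) = refl

  πᵛ-step : ∀ {x y} → Rot′ x y → (πᵛ x ≡ πᵛ y) ⊎ Rot (πᵛ x) (πᵛ y)
  πᵛ-step {zero , false} refl = inj₂ (πᵛ∘old succ-aᵇ)
  πᵛ-step {zero , true} refl = inj₁ refl
  πᵛ-step {suc zero , false} refl = inj₁ refl
  πᵛ-step {suc zero , true} refl = inj₂ (trans (πᵛ∘old bᵃ) (sym σ-pred-bᵃ))
  πᵛ-step {suc (suc j) , s} refl with σ′-old-view (j , s)
  ... | inj₁ (eq , q) = inj₁ (trans eq (cong πᵛ (sym q)))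
  ... | inj₂ (inj₁ (_ , eq , q)) = inj₁ (trans eq (cong πᵛ (sym q)))
  ... | inj₂ (inj₂ (_ , _ , q)) = inj₂ (trans (cong πᵛ q) (πᵛ∘old (σ (j , s))))

  AtNewVertex : NewDart → Set
  AtNewVertex x = x ≡ vᵃ ⊎ x ≡ vᵇ

  ¬AtNewVertex-aᵛ : ¬ AtNewVertex aᵛ
  ¬AtNewVertex-aᵛ (inj₁ ())
  ¬AtNewVertex-aᵛ (inj₂ ())
  ¬AtNewVertex-bᵛ : ¬ AtNewVertex bᵛ
  ¬AtNewVertex-bᵛ (inj₁ ())
  ¬AtNewVertex-bᵛ (inj₂ ())
  ¬AtNewVertex-old : ∀ d → ¬ AtNewVertex (old d)
  ¬AtNewVertex-old (j , s) (inj₁ ())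
  ¬AtNewVertex-old (j , s) (inj₂ ())

  AtNewVertex-stable : ∀ {x y} → Rot′ x y → AtNewVertex x → AtNewVertex y
  AtNewVertex-stable refl (inj₁ refl) = inj₂ refl
  AtNewVertex-stable refl (inj₂ refl) = inj₁ refl

  AtNewVertex-stable⁻ : ∀ {x y} → Rot′ x y → AtNewVertex y → AtNewVertex x
  AtNewVertex-stable⁻ {zero , false} refl z = ⊥-elim (¬AtNewVertex-old succ-aᵇ z)
  AtNewVertex-stable⁻ {zero , true} refl z = inj₁ refl
  AtNewVertex-stable⁻ {suc zero , false} refl z = inj₂ refl
  AtNewVertex-stable⁻ {suc zero , true} refl z = ⊥-elim (¬AtNewVertex-old bᵃ z)
  AtNewVertex-stable⁻ {suc (suc j) , s} refl z with σ′-old-view (j , s)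
  ... | inj₁ (_ , q) = ⊥-elim (¬AtNewVertex-aᵛ (subst AtNewVertex q z))
  ... | inj₂ (inj₁ (_ , _ , q)) = ⊥-elim (¬AtNewVertex-bᵛ (subst AtNewVertex q z))
  ... | inj₂ (inj₂ (_ , _ , q)) = ⊥-elim (¬AtNewVertex-old _ (subst AtNewVertex q z))

  reach-vertex : ∀ y → (∃ λ x → Star Rot′ (old x) y) ⊎ Star Rot′ vᵃ y
  reach-vertex (zero , false) = inj₁ (aᵇ , aᵇ↦aᵛ ◅ ε)
  reach-vertex (zero , true) = inj₂ ε
  reach-vertex (suc zero , false) = inj₂ (refl ◅ ε)
  reach-vertex (suc zero , true) = inj₁ (pred-bᵃ , pred-bᵃ↦bᵛ ◅ ε)
  reach-vertex (suc (suc j) , s) = inj₁ ((j , s) , ε)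

  NumClasses-vertex : ∀ {c} → NumClasses (Star Rot) c → NumClasses (Star Rot′) (suc c)
  NumClasses-vertex =
    NumClasses-retract-suc {R = Rot} {R′ = Rot′} old πᵛ (λ {x} → πᵛ-step {x}) πᵛ∘old (λ {x} → old-Rot {x})
      vᵃ AtNewVertex (inj₁ refl) (λ {x} → AtNewVertex-stable {x}) (λ {x} → AtNewVertex-stable⁻ {x})
      ¬AtNewVertex-old reach-vertex

  Face : OldDart → OldDart → Set
  Face x y = y ≡ σ (flip x)
  Face′ : NewDart → NewDart → Set
  Face′ x y = y ≡ σ′ (flip x)

  ιᶠ : OldDart → NewDart
  ιᶠ d with d ≟ᵈ bᵃ
  ... | yes _ = vᵃ
  ... | no _ = old d

  ιᶠ-view : ∀ d → (d ≡ bᵃ × ιᶠ d ≡ vᵃ) ⊎ (d ≢ bᵃ × ιᶠ d ≡ old d)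
  ιᶠ-view d with d ≟ᵈ bᵃ
  ... | yes x = inj₁ (x , refl)
  ... | no x = inj₂ (x , refl)

  ιᶠ-bᵃ : ιᶠ bᵃ ≡ vᵃ
  ιᶠ-bᵃ with ιᶠ-view bᵃ
  ... | inj₁ (_ , q) = q
  ... | inj₂ (ne , _) = ⊥-elim (ne refl)

  ιᶠ-old : ∀ d → d ≢ bᵃ → ιᶠ d ≡ old d
  ιᶠ-old d ne with ιᶠ-view d
  ... | inj₁ (eq , _) = ⊥-elim (ne eq)
  ... | inj₂ (_ , q) = q

  πᶠ : NewDart → OldDart
  πᶠ (zero , false) = bᵃ
  πᶠ (zero , true) = bᵃ
  πᶠ (suc zero , false) = bᵃ
  πᶠ (suc zero , true) = bᵃ
  πᶠ (suc (suc j) , s) = (j , s)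

  πᶠ∘old : ∀ d → πᶠ (old d) ≡ d
  πᶠ∘old (j , s) = refl

  πᶠ∘ιᶠ : ∀ x → πᶠ (ιᶠ x) ≡ x
  πᶠ∘ιᶠ x with ιᶠ-view x
  ... | inj₁ (eq , q) = trans (cong πᶠ q) (sym eq)
  ... | inj₂ (_ , q) = trans (cong πᶠ q) (πᶠ∘old x)

  flip≡aᵇ : ∀ {x} → flip x ≡ aᵇ → x ≡ bᵃ
  flip≡aᵇ {x} eq = trans (sym (flip-involutive x)) (cong flip eq)

  πᶠ-step : ∀ {x y} → Face′ x y → (πᶠ x ≡ πᶠ y) ⊎ Face (πᶠ x) (πᶠ y)
  πᶠ-step {zero , false} refl = inj₁ refl
  πᶠ-step {zero , true} refl = inj₂ (πᶠ∘old succ-aᵇ)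
  πᶠ-step {suc zero , false} refl = inj₁ (sym (πᶠ∘old bᵃ))
  πᶠ-step {suc zero , true} refl = inj₁ refl
  πᶠ-step {suc (suc j) , s} refl with σ′-old-view (j , not s)
  ... | inj₁ (eq , q) = inj₁ (trans (flip≡aᵇ {j , s} eq) (cong πᶠ (sym q)))
  ... | inj₂ (inj₁ (_ , eq , q)) = inj₂ (trans (cong πᶠ q) (sym (trans (cong σ eq) σ-pred-bᵃ)))
  ... | inj₂ (inj₂ (_ , _ , q)) = inj₂ (trans (cong πᶠ q) (πᶠ∘old _))

  ιᶠ-step : ∀ {x y} → Face x y → Star Face′ (ιᶠ x) (ιᶠ y)
  ιᶠ-step {x} refl with ιᶠ-view x
  ... | inj₁ (refl , q) =
        subst₂ (Star Face′) (sym q) (sym (ιᶠ-old succ-aᵇ succ-aᵇ≢bᵃ)) (refl ◅ ε)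
  ... | inj₂ (ne , q) with σ′-old-view (flip x)
  ...   | inj₁ (eq , _) = ⊥-elim (ne (flip≡aᵇ eq))
  ...   | inj₂ (inj₁ (_ , eq , q₂)) =
          subst₂ (Star Face′) (sym q) (sym (trans (cong ιᶠ (trans (cong σ eq) σ-pred-bᵃ)) ιᶠ-bᵃ))
            (sym (trans (σ′∘old (flip x)) q₂) ◅ (refl ◅ ε))
  ...   | inj₂ (inj₂ (_ , ne₂ , q₂)) =
          subst₂ (Star Face′) (sym q)
            (sym (ιᶠ-old (σ (flip x)) (λ h → ne₂ (σ-injective (trans h (sym σ-pred-bᵃ))))))
            (sym (trans (σ′∘old (flip x)) q₂) ◅ ε)

  InNewFace : NewDart → Set
  InNewFace x = x ≡ old bᵃ ⊎ (x ≡ aᵛ ⊎ x ≡ vᵇ)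

  ¬InNewFace-vᵃ : ¬ InNewFace vᵃ
  ¬InNewFace-vᵃ (inj₁ ())
  ¬InNewFace-vᵃ (inj₂ (inj₁ ()))
  ¬InNewFace-vᵃ (inj₂ (inj₂ ()))
  ¬InNewFace-bᵛ : ¬ InNewFace bᵛ
  ¬InNewFace-bᵛ (inj₁ ())
  ¬InNewFace-bᵛ (inj₂ (inj₁ ()))
  ¬InNewFace-bᵛ (inj₂ (inj₂ ()))
  ¬InNewFace-old : ∀ d → d ≢ bᵃ → ¬ InNewFace (old d)
  ¬InNewFace-old d ne (inj₁ eq) = ne (old-injective eq)
  ¬InNewFace-old (j , s) ne (inj₂ (inj₁ ()))
  ¬InNewFace-old (j , s) ne (inj₂ (inj₂ ()))

  InNewFace-stable : ∀ {x y} → Face′ x y → InNewFace x → InNewFace y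
  InNewFace-stable refl (inj₁ refl) = inj₂ (inj₁ (trans (σ′∘old aᵇ) σ′-old-aᵇ))
  InNewFace-stable refl (inj₂ (inj₁ refl)) = inj₂ (inj₂ refl)
  InNewFace-stable refl (inj₂ (inj₂ refl)) = inj₁ refl

  InNewFace-stable⁻ : ∀ {x y} → Face′ x y → InNewFace y → InNewFace x
  InNewFace-stable⁻ {zero , false} refl z = inj₂ (inj₁ refl)
  InNewFace-stable⁻ {zero , true} refl z = ⊥-elim (¬InNewFace-old succ-aᵇ succ-aᵇ≢bᵃ z)
  InNewFace-stable⁻ {suc zero , false} refl z = inj₂ (inj₂ refl)
  InNewFace-stable⁻ {suc zero , true} refl z = ⊥-elim (¬InNewFace-vᵃ z)
  InNewFace-stable⁻ {suc (suc j) , s} refl z with σ′-old-view (j , not s)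
  ... | inj₁ (eq , q) = inj₁ (cong old (flip≡aᵇ {j , s} eq))
  ... | inj₂ (inj₁ (_ , _ , q)) = ⊥-elim (¬InNewFace-bᵛ (subst InNewFace q z))
  ... | inj₂ (inj₂ (_ , ne₂ , q)) =
        ⊥-elim (¬InNewFace-old _ (λ h → ne₂ (σ-injective (trans h (sym σ-pred-bᵃ)))) (subst InNewFace q z))

  ¬InNewFace-ιᶠ : ∀ x → ¬ InNewFace (ιᶠ x)
  ¬InNewFace-ιᶠ x z with ιᶠ-view x
  ... | inj₁ (_ , q) = ¬InNewFace-vᵃ (subst InNewFace q z)
  ... | inj₂ (ne , q) = ¬InNewFace-old x ne (subst InNewFace q z)

  reach-face : ∀ y → (∃ λ x → Star Face′ (ιᶠ x) y) ⊎ Star Face′ aᵛ y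
  reach-face (zero , false) = inj₂ ε
  reach-face (zero , true) = inj₁ (bᵃ , subst (λ z → Star Face′ z vᵃ) (sym ιᶠ-bᵃ) ε)
  reach-face (suc zero , false) = inj₂ (refl ◅ ε)
  reach-face (suc zero , true) =
    inj₁ (flip pred-bᵃ , subst (λ z → Star Face′ z bᵛ) (sym (ιᶠ-old (flip pred-bᵃ) flip-pred-bᵃ≢bᵃ))
      (trans pred-bᵃ↦bᵛ (cong (σ′ ∘ old) (sym (flip-involutive pred-bᵃ))) ◅ ε))
  reach-face (suc (suc j) , s) with (j , s) ≟ᵈ bᵃ
  ... | yes refl = inj₂ (refl ◅ (refl ◅ ε))
  ... | no ne = inj₁ ((j , s) , subst (λ z → Star Face′ z _) (sym (ιᶠ-old (j , s) ne)) ε)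

  NumClasses-face : ∀ {c} → NumClasses (Star Face) c → NumClasses (Star Face′) (suc c)
  NumClasses-face =
    NumClasses-retract-suc {R = Face} {R′ = Face′} ιᶠ πᶠ (λ {x} → πᶠ-step {x}) πᶠ∘ιᶠ (λ {x} → ιᶠ-step {x})
      aᵛ InNewFace (inj₂ (inj₁ refl)) (λ {x} → InNewFace-stable {x}) (λ {x} → InNewFace-stable⁻ {x})
      ¬InNewFace-ιᶠ reach-face

  Comp : OldDart → OldDart → Set
  Comp x y = (y ≡ σ x) ⊎ (y ≡ flip x)
  Comp′ : NewDart → NewDart → Set
  Comp′ x y = (y ≡ σ′ x) ⊎ (y ≡ flip x)

  πᶜ : NewDart → OldDart
  πᶜ (zero , false) = aᵇ
  πᶜ (zero , true) = aᵇ
  πᶜ (suc zero , false) = aᵇ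
  πᶜ (suc zero , true) = bᵃ
  πᶜ (suc (suc j) , s) = (j , s)

  πᶜ∘old : ∀ d → πᶜ (old d) ≡ d
  πᶜ∘old (j , s) = refl

  πᶜ-step : ∀ {x y} → Comp′ x y → (πᶜ x ≡ πᶜ y) ⊎ Comp (πᶜ x) (πᶜ y)
  πᶜ-step {zero , false} (inj₁ refl) = inj₂ (inj₁ (πᶜ∘old succ-aᵇ))
  πᶜ-step {zero , true} (inj₁ refl) = inj₁ refl
  πᶜ-step {suc zero , false} (inj₁ refl) = inj₁ refl
  πᶜ-step {suc zero , true} (inj₁ refl) = inj₁ (sym (πᶜ∘old bᵃ))
  πᶜ-step {suc (suc j) , s} (inj₁ refl) with σ′-old-view (j , s)
  ... | inj₁ (eq , q) = inj₁ (trans eq (cong πᶜ (sym q)))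
  ... | inj₂ (inj₁ (_ , eq , q)) = inj₂ (inj₁ (trans (cong πᶜ q) (sym (trans (cong σ eq) σ-pred-bᵃ))))
  ... | inj₂ (inj₂ (_ , _ , q)) = inj₂ (inj₁ (trans (cong πᶜ q) (πᶜ∘old _)))
  πᶜ-step {zero , false} (inj₂ refl) = inj₁ refl
  πᶜ-step {zero , true} (inj₂ refl) = inj₁ refl
  πᶜ-step {suc zero , false} (inj₂ refl) = inj₂ (inj₂ refl)
  πᶜ-step {suc zero , true} (inj₂ refl) = inj₂ (inj₂ refl)
  πᶜ-step {suc (suc j) , s} (inj₂ refl) = inj₂ (inj₂ refl)

  old-Comp : ∀ {x y} → Comp x y → Star Comp′ (old x) (old y)
  old-Comp (inj₁ s) = Star-map inj₁ (old-Rot s)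
  old-Comp (inj₂ refl) = inj₂ refl ◅ ε

  reach-component : ∀ y → ∃ λ x → Star Comp′ (old x) y
  reach-component (zero , false) = aᵇ , inj₁ aᵇ↦aᵛ ◅ ε
  reach-component (zero , true) = aᵇ , inj₁ aᵇ↦aᵛ ◅ (inj₂ refl ◅ ε)
  reach-component (suc zero , false) = aᵇ , inj₁ aᵇ↦aᵛ ◅ (inj₂ refl ◅ (inj₁ refl ◅ ε))
  reach-component (suc zero , true) = pred-bᵃ , inj₁ (pred-bᵃ↦bᵛ) ◅ ε
  reach-component (suc (suc j) , s) = (j , s) , ε

  NumClasses-component : ∀ {c} → NumClasses (Star Comp) c → NumClasses (Star Comp′) c
  NumClasses-component =
    NumClasses-retract {R = Comp} {R′ = Comp′} old πᶜ (λ {x} → πᶜ-step {x}) πᶜ∘old (λ {x} → old-Comp {x})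
      reach-component

addCommonNeighbour-planar : ∀ {k m} (en : Fin (suc m) → Fin (suc k) × Fin (suc k)) e
                            (a≢b : proj₁ (en e) ≢ proj₂ (en e)) →
                            IsPlanar en → IsPlanar (addCommonNeighbour en (proj₁ (en e)) (proj₂ (en e)))
addCommonNeighbour-planar en e a≢b
  (σ , σ-bijective , σ-tail , σ-transitive , nv , nf , nc , vs , fs , cs , euler) =
  σ′ , σ′-bijective , σ′-tail , σ′-transitive σ-transitive ,
  suc nv , suc nf , nc , NumClasses-vertex vs , NumClasses-face fs , NumClasses-component cs ,
  trans (cong suc (+-suc nv nf)) (cong (λ z → suc (suc z)) euler)
  where
  open AddCommonNeighbourRotation en e a≢b σ σ-bijective σ-tail


lemma2p4 : ∀ (n t u : ℕ) → PlanarFeasible n t u →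
           PlanarFeasible (suc n) (2 * t + u) (t + u)
lemma2p4 n t u (k , m , en , k<n , simple , planar , e , a≢b , τ/e , τ-e) =
  suc k , suc (suc m) , addCommonNeighbour en a b , s≤s k<n ,
  addCommonNeighbour-simple en a≢b simple ,
  addCommonNeighbour-planar en e a≢b planar ,
  zero , (λ ()) ,
  HasTreeCount-addCommonNeighbour-contract en e a≢b τ/e τ-e ,
  HasTreeCount-addCommonNeighbour-delete en a b (deletion-contraction en e a≢b τ/e τ-e)
  where
  a b : Fin (suc k)
  a = proj₁ (en e)
  b = proj₂ (en e)
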